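{- For every $n\ge 0$, there is a bijection between the set of partitions of $\{1,2,\dots,n\}$ and the set of t-shelves of size $n$ in which no node that is a left child of its parent has a right child.
   Context: A treeshelf (t-shelf) of size $n\ge 1$ is a rooted binary tree with $n$ nodes labeled bijectively by $\{1,\dots,n\}$ so that labels strictly increase along every path starting at the root, in which every node has at most one left child and at most one right child, and every child (including a child with no sibling) is designated either as the left child or the right child of its parent. There is a unique empty t-shelf, of size $0$. -}

module Defs where

open import Data.Bool using (Bool; true; false; _∧_; _∨_; not; T)
open import Data.Nat using (ℕ; zero; suc; _<ᵇ_; _≡ᵇ_)
open import Data.List using (List; []; _∷_; length; _++_; map)
open import Data.Vec using (Vec; []; _∷_)
open import Data.Product using (Σ)

allL : {A : Set} → (A → Bool) → List A → Bool
allL p []       = true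
allL p (x ∷ xs) = p x ∧ allL p xs

anyL : {A : Set} → (A → Bool) → List A → Bool
anyL p []       = false
anyL p (x ∷ xs) = p x ∨ anyL p xs

range : ℕ → ℕ → List ℕ
range a zero    = []
range a (suc k) = a ∷ range (suc a) k

-- A subset of {1,...,n} is a characteristic vector  Vec Bool n
-- (position i stands for the element i+1).  A finite set of subsets
-- is encoded canonically as a strictly increasing list (w.r.t. the
-- lexicographic order) of subsets.

Subset : ℕ → Set
Subset n = Vec Bool n

lexLt : {n : ℕ} → Subset n → Subset n → Bool
lexLt []          []          = false
lexLt (false ∷ u) (true  ∷ v) = true
lexLt (true  ∷ u) (false ∷ v) = false
lexLt (false ∷ u) (false ∷ v) = lexLt u v
lexLt (true  ∷ u) (true  ∷ v) = lexLt u v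

strictlySorted : {n : ℕ} → List (Subset n) → Bool
strictlySorted []           = true
strictlySorted (x ∷ [])     = true
strictlySorted (x ∷ y ∷ xs) = lexLt x y ∧ strictlySorted (y ∷ xs)

nonempty : {n : ℕ} → Subset n → Bool
nonempty []      = false
nonempty (b ∷ u) = b ∨ nonempty u

disjoint : {n : ℕ} → Subset n → Subset n → Bool
disjoint []      []      = true
disjoint (a ∷ u) (b ∷ v) = not (a ∧ b) ∧ disjoint u v

pairwiseDisjoint : {n : ℕ} → List (Subset n) → Bool
pairwiseDisjoint []       = true
pairwiseDisjoint (x ∷ xs) = allL (disjoint x) xs ∧ pairwiseDisjoint xs

unionAll : {n : ℕ} → List (Subset n) → Subset n
unionAll {zero}  _  = []
unionAll {suc n} xs = anyL head xs ∷ unionAll (map tail xs)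
  where
  head : Subset (suc n) → Bool
  head (b ∷ _) = b
  tail : Subset (suc n) → Subset n
  tail (_ ∷ u) = u

full : {n : ℕ} → Subset n → Bool
full []      = true
full (b ∷ u) = b ∧ full u

isPartition : (n : ℕ) → List (Subset n) → Bool
isPartition n bs =
  strictlySorted bs ∧ allL nonempty bs ∧ pairwiseDisjoint bs ∧ full (unionAll bs)

Partition : ℕ → Set
Partition n = Σ (List (Subset n)) (λ bs → T (isPartition n bs))

-- A (possibly empty) binary tree in which every node has an optional
-- left child and an optional right child (the designation left/right
-- is part of the data), nodes carrying natural-number labels.

data BTree : Set where
  leaf : BTree
  node : BTree → ℕ → BTree → BTree

labels : BTree → List ℕ
labels leaf         = []
labels (node l x r) = labels l ++ (x ∷ labels r)

childGreater : ℕ → BTree → Bool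
childGreater x leaf         = true
childGreater x (node _ y _) = x <ᵇ y

increasing : BTree → Bool
increasing leaf         = true
increasing (node l x r) =
  childGreater x l ∧ childGreater x r ∧ increasing l ∧ increasing r

bijLabels : ℕ → BTree → Bool
bijLabels n t =
  (length (labels t) ≡ᵇ n) ∧ allL (λ k → anyL (λ x → x ≡ᵇ k) (labels t)) (range 1 n)

isTShelf : ℕ → BTree → Bool
isTShelf n t = bijLabels n t ∧ increasing t

hasRightChild : BTree → Bool
hasRightChild leaf                = false
hasRightChild (node _ _ leaf)     = false
hasRightChild (node _ _ (node _ _ _)) = true

noLeftChildWithRightChild : BTree → Bool
noLeftChildWithRightChild leaf         = true
noLeftChildWithRightChild (node l x r) =
  not (hasRightChild l) ∧ noLeftChildWithRightChild l ∧ noLeftChildWithRightChild r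

TShelf : ℕ → Set
TShelf n = Σ BTree (λ t → T (isTShelf n t))

RestrictedTShelf : ℕ → Set
RestrictedTShelf n =
  Σ BTree (λ t → T (isTShelf n t ∧ noLeftChildWithRightChild t))

-- A partition of {1,…,n+1} is a partition of the other n elements together with a choice: the
-- remaining element either forms a block of its own or joins one of the k existing blocks. In a
-- t-shelf where no left child has a right child, everything below a node of the right spine is a
-- left chain, so the node n+1 (a leaf, being the largest label) either ends the right spine or ends
-- the left chain below one of the k spine nodes. Both families thus grow by the same rule, with k
-- (blocks, spine nodes) increasing exactly when a new block or spine node is created, and induction
-- on n transfers the bijection one element at a time while keeping k matched.
module Submission where

open import Algebra.Bundles using (CommutativeMonoid)
open import Data.Bool using (Bool; true; false; _∧_; _∨_; not; T; if_then_else_)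
open import Data.Bool.Properties
  using (T-irrelevant; T-≡; T-∧; T-∨; ∧-comm; ∧-assoc; ∨-identityˡ; ∨-identityʳ; ∨-zeroʳ;
         ∧-commutativeMonoid; ∨-commutativeMonoid)
open import Data.Empty using (⊥-elim)
open import Data.List using (List; []; _∷_; length; _++_; map; [_])
open import Data.List.Membership.Propositional using (_∈_)
open import Data.List.Membership.Propositional.Properties using (∈-∃++; ∈-++⁺ˡ; ∈-++⁺ʳ; ∈-++⁻)
open import Data.List.Properties using (length-++; length-map; ++-conicalʳ)
open import Data.List.Relation.Binary.Permutation.Propositional using (_↭_; prep; swap; ↭-reflexive; ↭-sym)
import Data.List.Relation.Binary.Permutation.Propositional as ↭
open import Data.List.Relation.Binary.Permutation.Propositional.Properties
  using (++-comm; ↭-length; ++⁺ˡ; shift; drop-∷; ∈-resp-↭; ↭-empty-inv)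
open import Data.List.Relation.Unary.All using (All; []; _∷_)
import Data.List.Relation.Unary.All as All
open import Data.List.Relation.Unary.Any using (here; there)
open import Data.Nat using (ℕ; zero; suc; _+_; _≤_; _<_; _≡ᵇ_; z<s; s<s; s<s⁻¹; s≤s; s≤s⁻¹)
open import Data.Nat.Properties
  using (+-comm; +-identityʳ; +-suc; m≤m+n; <⇒≤; ≤-refl; <-irrefl; suc-injective;
         <⇒<ᵇ; <ᵇ⇒<; ≡ᵇ⇒≡; ≡⇒≡ᵇ; <⇒≢; <⇒≱)
open import Data.Product using (Σ; _×_; _,_; proj₁; proj₂; uncurry)
import Data.Product as Product
open import Data.Product.Properties using (Σ-≡,≡→≡)
open import Data.Sum using (_⊎_; inj₁; inj₂)
import Data.Sum as Sum
open import Data.Unit using (⊤)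
open import Data.Vec using ([]; _∷_)
import Data.Vec as Vec
open import Data.Vec.Properties using (zipWith-identityˡ)
open import Function using (_∘_)
open import Function.Bundles using (Equivalence; _⤖_; mk↔ₛ′)
open import Function.Properties.Inverse using (↔⇒⤖)
open import Relation.Binary.PropositionalEquality
  using (_≡_; _≢_; refl; sym; trans; cong; cong₂; subst; module ≡-Reasoning)
open import Relation.Nullary using (¬_)

open import Algebra.Properties.CommutativeSemigroup (CommutativeMonoid.commutativeSemigroup ∧-commutativeMonoid)
  using () renaming (x∙yz≈y∙xz to ∧-swap; interchange to ∧-interchange)
open import Algebra.Properties.CommutativeSemigroup (CommutativeMonoid.commutativeSemigroup ∨-commutativeMonoid)
  using () renaming (x∙yz≈y∙xz to ∨-swap)
open import Defs

T-∧⁻ : ∀ x {y} → T (x ∧ y) → T x × T y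
T-∧⁻ x = Equivalence.to (T-∧ {x})

T-∧⁺ : ∀ {x y} → T x → T y → T (x ∧ y)
T-∧⁺ p q = Equivalence.from T-∧ (p , q)

T-∨⁺ˡ : ∀ {x y} → T x → T (x ∨ y)
T-∨⁺ˡ p = Equivalence.from T-∨ (inj₁ p)

T-∨⁺ʳ : ∀ x {y} → T y → T (x ∨ y)
T-∨⁺ʳ x p = Equivalence.from (T-∨ {x}) (inj₂ p)

-- Growth families

-- How a new element attaches to an object with k "slots" (blocks, spine nodes): in a fresh slot,
-- or in slot i. The bound is irrelevant, so choices with the same index are definitionally equal.
data Choice (k : ℕ) : Set where
  fresh    : Choice k
  existing : (i : ℕ) → .(i < k) → Choice k

growth : ∀ {k} → Choice k → ℕ
growth fresh          = 1
growth (existing _ _) = 0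

castChoice : ∀ {k l} → k ≡ l → Choice k → Choice l
castChoice e fresh          = fresh
castChoice e (existing i p) = existing i (subst (i <_) e p)

growth-castChoice : ∀ {k l} (e : k ≡ l) (c : Choice k) → growth (castChoice e c) ≡ growth c
growth-castChoice e fresh          = refl
growth-castChoice e (existing i p) = refl

castChoice-id : ∀ {k} (e : k ≡ k) (c : Choice k) → castChoice e c ≡ c
castChoice-id e fresh          = refl
castChoice-id e (existing i p) = refl

castChoice-∘ : ∀ {k l m} (e : l ≡ m) (e′ : k ≡ l) (c : Choice k) →
               castChoice e (castChoice e′ c) ≡ castChoice (trans e′ e) c
castChoice-∘ e e′ fresh          = refl
castChoice-∘ e e′ (existing i p) = refl

existing-≡ : ∀ {A : Set} {size : A → ℕ} {x y : A} {i j : ℕ} .{i< : i < size x} .{j< : j < size y} →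
             x ≡ y → i ≡ j → _≡_ {A = Σ A (Choice ∘ size)} (x , existing i i<) (y , existing j j<)
existing-≡ refl refl = refl

record GrowthFamily : Set₁ where
  field
    Obj             : ℕ → Set
    size            : ∀ {n} → Obj n → ℕ
    empty           : Obj 0
    empty-unique    : (x : Obj 0) → x ≡ empty
    size-empty      : size empty ≡ 0
    extend          : ∀ {n} (x : Obj n) → Choice (size x) → Obj (suc n)
    restrict        : ∀ {n} → Obj (suc n) → Σ (Obj n) (Choice ∘ size)
    extend-restrict : ∀ {n} (x : Obj (suc n)) → uncurry extend (restrict x) ≡ x
    restrict-extend : ∀ {n} (x : Obj n) (c : Choice (size x)) → restrict (extend x c) ≡ (x , c)
    size-extend     : ∀ {n} (x : Obj n) (c : Choice (size x)) → size (extend x c) ≡ size x + growth c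

  extend-cong : ∀ {n} {x y : Obj n} → x ≡ y → (e : size x ≡ size y) (c : Choice (size x)) →
                extend x c ≡ extend y (castChoice e c)
  extend-cong refl e c = cong (extend _) (sym (castChoice-id e c))

open GrowthFamily using (Obj)

module Transfer (F G : GrowthFamily) where
  private
    module F = GrowthFamily F
    module G = GrowthFamily G

  transfer      : ∀ n → F.Obj n → G.Obj n
  transfer-size : ∀ n (x : F.Obj n) → G.size (transfer n x) ≡ F.size x

  transferStep : ∀ n → Σ (F.Obj n) (Choice ∘ F.size) → G.Obj (suc n)
  transferStep n (x , c) = G.extend (transfer n x) (castChoice (sym (transfer-size n x)) c)

  transfer zero    _ = G.empty
  transfer (suc n) = transferStep n ∘ F.restrict

  transferStep-size : ∀ n (r : Σ (F.Obj n) (Choice ∘ F.size)) →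
                      G.size (transferStep n r) ≡ F.size (uncurry F.extend r)
  transferStep-size n (x , c) = begin
    G.size (G.extend (transfer n x) c′)   ≡⟨ G.size-extend (transfer n x) c′ ⟩
    G.size (transfer n x) + growth c′     ≡⟨ cong₂ _+_ (transfer-size n x) (growth-castChoice _ c) ⟩
    F.size x + growth c                   ≡⟨ sym (F.size-extend x c) ⟩
    F.size (F.extend x c)                 ∎
    where
    open ≡-Reasoning
    c′ = castChoice (sym (transfer-size n x)) c

  transfer-size zero    x = trans G.size-empty (sym (trans (cong F.size (F.empty-unique x)) F.size-empty))
  transfer-size (suc n) x = trans (transferStep-size n (F.restrict x)) (cong F.size (F.extend-restrict x))

module _ (F G : GrowthFamily) where
  private
    module F = GrowthFamily F
    module G = GrowthFamily G
    open Transfer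
    forth = transfer F G
    back  = transfer G F

  transfer-inverse : ∀ n (x : F.Obj n) → back n (forth n x) ≡ x
  transfer-inverse zero    x = sym (F.empty-unique x)
  transfer-inverse (suc n) x = begin
    back (suc n) (G.extend (forth n y) c′)
      ≡⟨ cong (transferStep G F n) (G.restrict-extend (forth n y) c′) ⟩
    F.extend (back n (forth n y)) (castChoice e₁ (castChoice e₂ c))
      ≡⟨ cong (F.extend _) (castChoice-∘ e₁ e₂ c) ⟩
    F.extend (back n (forth n y)) (castChoice (trans e₂ e₁) c)
      ≡⟨ sym (F.extend-cong (sym (transfer-inverse n y)) (trans e₂ e₁) c) ⟩
    F.extend y c
      ≡⟨ F.extend-restrict x ⟩
    x ∎
    where
    open ≡-Reasoning
    y  = proj₁ (F.restrict x)
    c  = proj₂ (F.restrict x)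
    e₂ = sym (transfer-size F G n y)
    e₁ = sym (transfer-size G F n (forth n y))
    c′ = castChoice e₂ c

growthFamily-⤖ : (F G : GrowthFamily) (n : ℕ) → Obj F n ⤖ Obj G n
growthFamily-⤖ F G n = ↔⇒⤖ (mk↔ₛ′ (Transfer.transfer F G n) (Transfer.transfer G F n)
                                 (transfer-inverse G F n) (transfer-inverse F G n))

-- Partition and RestrictedTShelf both have the form Σ raw (T ∘ valid n).
record ValidGrowth : Set₁ where
  field
    Raw             : ℕ → Set
    valid           : ∀ n → Raw n → Bool
    size            : ∀ {n} → Raw n → ℕ
    empty           : Raw 0
    empty-valid     : T (valid 0 empty)
    empty-unique    : (x : Raw 0) → T (valid 0 x) → x ≡ empty
    size-empty      : size empty ≡ 0
    extend          : ∀ {n} (x : Raw n) → Choice (size x) → Raw (suc n)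
    restrict        : ∀ {n} → Raw (suc n) → Σ (Raw n) (Choice ∘ size)
    extend-valid    : ∀ {n} (x : Raw n) (c : Choice (size x)) → T (valid n x) → T (valid (suc n) (extend x c))
    restrict-valid  : ∀ {n} (x : Raw (suc n)) → T (valid (suc n) x) → T (valid n (proj₁ (restrict x)))
    extend-restrict : ∀ {n} (x : Raw (suc n)) → T (valid (suc n) x) → uncurry extend (restrict x) ≡ x
    restrict-extend : ∀ {n} (x : Raw n) (c : Choice (size x)) → T (valid n x) → restrict (extend x c) ≡ (x , c)
    size-extend     : ∀ {n} (x : Raw n) (c : Choice (size x)) → size (extend x c) ≡ size x + growth c

  refine-≡ : ∀ {n} {x y : Raw n} {c : Choice (size x)} {d : Choice (size y)}
               {v : T (valid n x)} {w : T (valid n y)} →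
             _≡_ {A = Σ (Raw n) (Choice ∘ size)} (x , c) (y , d) →
             _≡_ {A = Σ (Σ (Raw n) (T ∘ valid n)) (Choice ∘ size ∘ proj₁)} ((x , v) , c) ((y , w) , d)
  refine-≡ {n} {x} refl = cong (λ v → (x , v) , _) (T-irrelevant _ _)

  growthFamily : GrowthFamily
  growthFamily = record
    { Obj             = λ n → Σ (Raw n) (T ∘ valid n)
    ; size            = size ∘ proj₁
    ; empty           = empty , empty-valid
    ; empty-unique    = λ (x , v) → Σ-≡,≡→≡ (empty-unique x v , T-irrelevant _ _)
    ; size-empty      = size-empty
    ; extend          = λ (x , v) c → extend x c , extend-valid x c v
    ; restrict        = λ (x , v) → (proj₁ (restrict x) , restrict-valid x v) , proj₂ (restrict x)
    ; extend-restrict = λ (x , v) → Σ-≡,≡→≡ (extend-restrict x v , T-irrelevant _ _)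
    ; restrict-extend = λ (x , v) c → refine-≡ (restrict-extend x c v)
    ; size-extend     = λ (x , v) c → size-extend x c
    }

_≺_ : ∀ {n} → Subset n → Subset n → Set
x ≺ y = T (lexLt x y)

≺-trans : ∀ {n} (x y z : Subset n) → x ≺ y → y ≺ z → x ≺ z
≺-trans []          []          []          ()
≺-trans (false ∷ x) (false ∷ y) (false ∷ z) p q = ≺-trans x y z p q
≺-trans (false ∷ x) (false ∷ y) (true  ∷ z) p q = _
≺-trans (false ∷ x) (true  ∷ y) (true  ∷ z) p q = _
≺-trans (true  ∷ x) (true  ∷ y) (true  ∷ z) p q = ≺-trans x y z p q
≺-trans (false ∷ x) (true  ∷ y) (false ∷ z) p ()
≺-trans (true  ∷ x) (false ∷ y) z           () q
≺-trans (true  ∷ x) (true  ∷ y) (false ∷ z) p ()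

≺-asym : ∀ {n} (x y : Subset n) → x ≺ y → lexLt y x ≡ false
≺-asym []          []          ()
≺-asym (false ∷ x) (false ∷ y) p = ≺-asym x y p
≺-asym (false ∷ x) (true  ∷ y) p = refl
≺-asym (true  ∷ x) (false ∷ y) ()
≺-asym (true  ∷ x) (true  ∷ y) p = ≺-asym x y p

≺-connex : ∀ {n} (x y : Subset n) → lexLt x y ≡ false → x ≡ y ⊎ y ≺ x
≺-connex []          []          _ = inj₁ refl
≺-connex (false ∷ x) (false ∷ y) e = Sum.map₁ (cong (false ∷_)) (≺-connex x y e)
≺-connex (false ∷ x) (true  ∷ y) ()
≺-connex (true  ∷ x) (false ∷ y) e = inj₂ _
≺-connex (true  ∷ x) (true  ∷ y) e = Sum.map₁ (cong (true ∷_)) (≺-connex x y e)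

∅ : ∀ {n} → Subset n
∅ = Vec.replicate _ false

_∪_ : ∀ {n} → Subset n → Subset n → Subset n
_∪_ = Vec.zipWith _∨_

∪-identityˡ : ∀ {n} (u : Subset n) → ∅ ∪ u ≡ u
∪-identityˡ = zipWith-identityˡ ∨-identityˡ

∪-swap : ∀ {n} (u v w : Subset n) → u ∪ (v ∪ w) ≡ v ∪ (u ∪ w)
∪-swap []      []      []      = refl
∪-swap (a ∷ u) (b ∷ v) (c ∷ w) = cong₂ _∷_ (∨-swap a b c) (∪-swap u v w)

nonempty-∅ : ∀ n → nonempty (∅ {n}) ≡ false
nonempty-∅ zero    = refl
nonempty-∅ (suc n) = nonempty-∅ n

nonempty-false : ∀ {n} (u : Subset n) → nonempty u ≡ false → u ≡ ∅
nonempty-false []          _ = refl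
nonempty-false (false ∷ u) e = cong (false ∷_) (nonempty-false u e)

disjoint-comm : ∀ {n} (u v : Subset n) → disjoint u v ≡ disjoint v u
disjoint-comm []      []      = refl
disjoint-comm (a ∷ u) (b ∷ v) = cong₂ (λ x y → not x ∧ y) (∧-comm a b) (disjoint-comm u v)

disjoint-∅ : ∀ {n} (u : Subset n) → disjoint ∅ u ≡ true
disjoint-∅ []      = refl
disjoint-∅ (b ∷ u) = disjoint-∅ u

nonempty⇒¬disjoint-self : ∀ {n} (u : Subset n) → T (nonempty u) → ¬ T (disjoint u u)
nonempty⇒¬disjoint-self (true  ∷ u) _  ()
nonempty⇒¬disjoint-self (false ∷ u) ne d = nonempty⇒¬disjoint-self u ne d

unionAll-∷ : ∀ {n} (u : Subset n) (us : List (Subset n)) → unionAll (u ∷ us) ≡ u ∪ unionAll us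
unionAll-∷ {zero}  []      us = refl
unionAll-∷ {suc n} (b ∷ u) us = cong ((b ∨ _) ∷_) (unionAll-∷ u _)

unionAll-map-false∷ : ∀ {n} (us : List (Subset n)) → unionAll (map (false ∷_) us) ≡ false ∷ unionAll us
unionAll-map-false∷ []       = refl
unionAll-map-false∷ (u ∷ us) = begin
  unionAll ((false ∷ u) ∷ map (false ∷_) us) ≡⟨ unionAll-∷ (false ∷ u) _ ⟩
  (false ∷ u) ∪ unionAll (map (false ∷_) us) ≡⟨ cong ((false ∷ u) ∪_) (unionAll-map-false∷ us) ⟩
  false ∷ (u ∪ unionAll us)                  ≡⟨ cong (false ∷_) (sym (unionAll-∷ u us)) ⟩
  false ∷ unionAll (u ∷ us)                  ∎
  where open ≡-Reasoning

allL⇒All : ∀ {A : Set} (p : A → Bool) (xs : List A) → T (allL p xs) → All (T ∘ p) xs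
allL⇒All p []       _ = []
allL⇒All p (x ∷ xs) v = proj₁ (T-∧⁻ (p x) v) ∷ allL⇒All p xs (proj₂ (T-∧⁻ (p x) v))

allL-map : ∀ {A B : Set} (p : B → Bool) (f : A → B) (xs : List A) → allL p (map f xs) ≡ allL (p ∘ f) xs
allL-map p f []       = refl
allL-map p f (x ∷ xs) = cong (p (f x) ∧_) (allL-map p f xs)

allL-↭ : ∀ {A : Set} (p : A → Bool) {xs ys : List A} → xs ↭ ys → allL p xs ≡ allL p ys
allL-↭ p ↭.refl          = refl
allL-↭ p (prep x q)      = cong (p x ∧_) (allL-↭ p q)
allL-↭ p (swap x y q)    = trans (cong (λ b → p x ∧ (p y ∧ b)) (allL-↭ p q)) (∧-swap (p x) (p y) _)
allL-↭ p (↭.trans q q′)  = trans (allL-↭ p q) (allL-↭ p q′)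

pairwiseDisjoint-↭ : ∀ {n} {xs ys : List (Subset n)} → xs ↭ ys → pairwiseDisjoint xs ≡ pairwiseDisjoint ys
pairwiseDisjoint-↭ ↭.refl         = refl
pairwiseDisjoint-↭ (prep x q)     = cong₂ _∧_ (allL-↭ (disjoint x) q) (pairwiseDisjoint-↭ q)
pairwiseDisjoint-↭ {xs = x ∷ y ∷ xs} {y ∷ x ∷ ys} (swap x y q) = begin
  (disjoint x y ∧ allL (disjoint x) xs) ∧ (allL (disjoint y) xs ∧ pairwiseDisjoint xs)
    ≡⟨ cong₂ (λ a b → (disjoint x y ∧ a) ∧ b) (allL-↭ (disjoint x) q)
             (cong₂ _∧_ (allL-↭ (disjoint y) q) (pairwiseDisjoint-↭ q)) ⟩
  (disjoint x y ∧ allL (disjoint x) ys) ∧ (allL (disjoint y) ys ∧ pairwiseDisjoint ys)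
    ≡⟨ ∧-interchange (disjoint x y) _ _ _ ⟩
  (disjoint x y ∧ allL (disjoint y) ys) ∧ (allL (disjoint x) ys ∧ pairwiseDisjoint ys)
    ≡⟨ cong (λ d → (d ∧ _) ∧ _) (disjoint-comm x y) ⟩
  (disjoint y x ∧ allL (disjoint y) ys) ∧ (allL (disjoint x) ys ∧ pairwiseDisjoint ys) ∎
  where open ≡-Reasoning
pairwiseDisjoint-↭ (↭.trans q q′) = trans (pairwiseDisjoint-↭ q) (pairwiseDisjoint-↭ q′)

unionAll-↭ : ∀ {n} {xs ys : List (Subset n)} → xs ↭ ys → unionAll xs ≡ unionAll ys
unionAll-↭ ↭.refl         = refl
unionAll-↭ {xs = _ ∷ xs} {_ ∷ ys} (prep x q) = begin
  unionAll (x ∷ xs) ≡⟨ unionAll-∷ x xs ⟩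
  x ∪ unionAll xs   ≡⟨ cong (x ∪_) (unionAll-↭ q) ⟩
  x ∪ unionAll ys   ≡⟨ sym (unionAll-∷ x ys) ⟩
  unionAll (x ∷ ys) ∎
  where open ≡-Reasoning
unionAll-↭ {xs = _ ∷ _ ∷ xs} {_ ∷ _ ∷ ys} (swap x y q) = begin
  unionAll (x ∷ y ∷ xs)    ≡⟨ unionAll-∷ x _ ⟩
  x ∪ unionAll (y ∷ xs)    ≡⟨ cong (x ∪_) (unionAll-∷ y xs) ⟩
  x ∪ (y ∪ unionAll xs)    ≡⟨ cong (λ u → x ∪ (y ∪ u)) (unionAll-↭ q) ⟩
  x ∪ (y ∪ unionAll ys)    ≡⟨ ∪-swap x y _ ⟩
  y ∪ (x ∪ unionAll ys)    ≡⟨ cong (y ∪_) (sym (unionAll-∷ x ys)) ⟩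
  y ∪ unionAll (x ∷ ys)    ≡⟨ sym (unionAll-∷ y _) ⟩
  unionAll (y ∷ x ∷ ys)    ∎
  where open ≡-Reasoning
unionAll-↭ (↭.trans q q′) = trans (unionAll-↭ q) (unionAll-↭ q′)

strictlySorted-∷⁻ : ∀ {n} (x : Subset n) (xs : List (Subset n)) →
                    T (strictlySorted (x ∷ xs)) → All (x ≺_) xs × T (strictlySorted xs)
strictlySorted-∷⁻ x []       _ = [] , _
strictlySorted-∷⁻ x (y ∷ xs) s with T-∧⁻ (lexLt x y) s
... | x≺y , s′ = x≺y ∷ All.map (≺-trans x y _ x≺y) (proj₁ (strictlySorted-∷⁻ y xs s′)) , s′

strictlySorted-∷⁺ : ∀ {n} {x : Subset n} {xs : List (Subset n)} →
                    All (x ≺_) xs → T (strictlySorted xs) → T (strictlySorted (x ∷ xs))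
strictlySorted-∷⁺ []          _ = _
strictlySorted-∷⁺ (x≺y ∷ _)  s = T-∧⁺ x≺y s

insert : ∀ {n} → Subset n → List (Subset n) → List (Subset n)
insert b []       = [ b ]
insert b (x ∷ xs) = if lexLt x b then x ∷ insert b xs else b ∷ x ∷ xs

insertPosition : ∀ {n} → Subset n → List (Subset n) → ℕ
insertPosition b []       = 0
insertPosition b (x ∷ xs) = if lexLt x b then suc (insertPosition b xs) else 0

insertPosition-< : ∀ {n} (b : Subset n) (xs : List (Subset n)) → insertPosition b xs < length (insert b xs)
insertPosition-< b []       = z<s
insertPosition-< b (x ∷ xs) with lexLt x b
... | true  = s<s (insertPosition-< b xs)
... | false = z<s

insert-↭ : ∀ {n} (b : Subset n) (xs : List (Subset n)) → insert b xs ↭ b ∷ xs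
insert-↭ b []       = ↭.refl
insert-↭ b (x ∷ xs) with lexLt x b
... | true  = ↭.trans (prep x (insert-↭ b xs)) (swap x b ↭.refl)
... | false = ↭.refl

insert⁺ : ∀ {n} {P : Subset n → Set} {b : Subset n} (xs : List (Subset n)) → P b → All P xs → All P (insert b xs)
insert⁺ []       pb []         = pb ∷ []
insert⁺ {b = b} (x ∷ xs) pb (px ∷ pxs) with lexLt x b
... | true  = px ∷ insert⁺ xs pb pxs
... | false = pb ∷ px ∷ pxs

insert-sorted : ∀ {n} (b : Subset n) (xs : List (Subset n)) →
                All (_≢ b) xs → T (strictlySorted xs) → T (strictlySorted (insert b xs))
insert-sorted b []       _          _ = _
insert-sorted b (x ∷ xs) (x≢b ∷ ne) s with lexLt x b in x<b
... | true  = strictlySorted-∷⁺ (insert⁺ xs (subst T (sym x<b) _) (proj₁ (strictlySorted-∷⁻ x xs s)))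
                                (insert-sorted b xs ne (proj₂ (strictlySorted-∷⁻ x xs s)))
... | false with ≺-connex x b x<b
...   | inj₁ x≡b = ⊥-elim (x≢b x≡b)
...   | inj₂ b≺x = T-∧⁺ b≺x s

pick : ∀ {A : Set} (i : ℕ) (xs : List A) → .(i < length xs) → A × List A
pick i       []       ()
pick zero    (x ∷ xs) _   = x , xs
pick (suc i) (x ∷ xs) i<  = Product.map₂ (x ∷_) (pick i xs (s<s⁻¹ i<))

pick-↭ : ∀ {A : Set} (i : ℕ) (xs : List A) .(i< : i < length xs) →
         xs ↭ proj₁ (pick i xs i<) ∷ proj₂ (pick i xs i<)
pick-↭ i       []       ()
pick-↭ zero    (x ∷ xs) _  = ↭.refl
pick-↭ (suc i) (x ∷ xs) i< = ↭.trans (prep x (pick-↭ i xs (s<s⁻¹ i<))) (swap x _ ↭.refl)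

pick⁺ : ∀ {A : Set} {P : A → Set} (i : ℕ) {xs : List A} .(i< : i < length xs) →
        All P xs → P (proj₁ (pick i xs i<)) × All P (proj₂ (pick i xs i<))
pick⁺ i       {[]}     () _
pick⁺ zero    {x ∷ xs} _  (px ∷ pxs) = px , pxs
pick⁺ (suc i) {x ∷ xs} i< (px ∷ pxs) = Product.map₂ (px ∷_) (pick⁺ i (s<s⁻¹ i<) pxs)

pick-sorted : ∀ {n} (i : ℕ) (xs : List (Subset n)) .(i< : i < length xs) →
              T (strictlySorted xs) → T (strictlySorted (proj₂ (pick i xs i<)))
pick-sorted i       []       () _
pick-sorted zero    (x ∷ xs) _  s = proj₂ (strictlySorted-∷⁻ x xs s)
pick-sorted (suc i) (x ∷ xs) i< s =
  strictlySorted-∷⁺ (proj₂ (pick⁺ i (s<s⁻¹ i<) (proj₁ (strictlySorted-∷⁻ x xs s))))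
                    (pick-sorted i xs (s<s⁻¹ i<) (proj₂ (strictlySorted-∷⁻ x xs s)))

pick-insert : ∀ {n} (b : Subset n) (xs : List (Subset n)) →
              pick (insertPosition b xs) (insert b xs) (insertPosition-< b xs) ≡ (b , xs)
pick-insert b []       = refl
pick-insert b (x ∷ xs) with lexLt x b
... | true  = cong (Product.map₂ (x ∷_)) (pick-insert b xs)
... | false = refl

insert-pick : ∀ {n} (i : ℕ) (xs : List (Subset n)) .(i< : i < length xs) → T (strictlySorted xs) →
              let (y , ys) = pick i xs i< in insert y ys ≡ xs × insertPosition y ys ≡ i
insert-pick i       []            () _
insert-pick zero    (x ∷ [])      _  _ = refl , refl
insert-pick zero    (x ∷ z ∷ xs)  _  s
  rewrite ≺-asym x z (proj₁ (T-∧⁻ (lexLt x z) s)) = refl , refl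
insert-pick (suc i) (x ∷ xs)      i< s
  with pick i xs (s<s⁻¹ i<) | pick⁺ i (s<s⁻¹ i<) (proj₁ (strictlySorted-∷⁻ x xs s))
     | insert-pick i xs (s<s⁻¹ i<) (proj₂ (strictlySorted-∷⁻ x xs s))
... | y , ys | x≺y , _ | ins , pos rewrite Equivalence.to T-≡ x≺y = cong (x ∷_) ins , cong suc pos

-- Set partitions

isCover : ∀ {n} → List (Subset n) → Bool
isCover bs = allL nonempty bs ∧ pairwiseDisjoint bs ∧ full (unionAll bs)

isCover-↭ : ∀ {n} {xs ys : List (Subset n)} → xs ↭ ys → isCover xs ≡ isCover ys
isCover-↭ q = cong₂ _∧_ (allL-↭ nonempty q) (cong₂ _∧_ (pairwiseDisjoint-↭ q) (cong full (unionAll-↭ q)))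

coverWith : ∀ {n} → Subset n → List (Subset n) → Bool
coverWith b qs = allL nonempty qs ∧ pairwiseDisjoint (b ∷ qs) ∧ full (unionAll (b ∷ qs))

isCover-∷ : ∀ {n} (b : Subset n) (qs : List (Subset n)) → isCover (b ∷ qs) ≡ nonempty b ∧ coverWith b qs
isCover-∷ b qs = ∧-assoc (nonempty b) _ _

coverWith-∅ : ∀ {n} (qs : List (Subset n)) → coverWith ∅ qs ≡ isCover qs
coverWith-∅ qs = cong₂ (λ d u → allL nonempty qs ∧ (d ∧ pairwiseDisjoint qs) ∧ full u)
                       (allL-∅ qs) (trans (unionAll-∷ ∅ qs) (∪-identityˡ _))
  where
  allL-∅ : ∀ {n} (qs : List (Subset n)) → allL (disjoint ∅) qs ≡ true
  allL-∅ []       = refl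
  allL-∅ (q ∷ qs) = cong₂ _∧_ (disjoint-∅ q) (allL-∅ qs)

-- Element 1 is the first coordinate; the block containing it is the lexicographically largest.
join : ∀ {n} → List (Subset n) → Subset n → List (Subset (suc n))
join qs b = map (false ∷_) qs ++ [ true ∷ b ]

split : ∀ {n} → List (Subset (suc n)) → List (Subset n) × Subset n
split []                 = [] , ∅
split ((false ∷ u) ∷ bs) = Product.map₁ (u ∷_) (split bs)
split ((true  ∷ u) ∷ _)  = [] , u

split-join : ∀ {n} (qs : List (Subset n)) (b : Subset n) → split (join qs b) ≡ (qs , b)
split-join []       b = refl
split-join (q ∷ qs) b = cong (Product.map₁ (q ∷_)) (split-join qs b)

isPartition⁻ : ∀ n (bs : List (Subset n)) → T (isPartition n bs) →
               T (strictlySorted bs) × T (pairwiseDisjoint bs) × T (full (unionAll bs))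
isPartition⁻ n bs v with T-∧⁻ (strictlySorted bs) v
... | s , c with T-∧⁻ (allL nonempty bs) c
...   | _ , c′ with T-∧⁻ (pairwiseDisjoint bs) c′
...     | d , f = s , d , f

join-split : ∀ {n} (bs : List (Subset (suc n))) → T (isPartition (suc n) bs) → uncurry join (split bs) ≡ bs
join-split {n} bs v with isPartition⁻ (suc n) bs v
... | s , d , f = go bs s d (proj₁ (T-∧⁻ (Vec.head (unionAll bs)) f))
  where
  go : ∀ bs → T (strictlySorted bs) → T (pairwiseDisjoint bs) → T (Vec.head (unionAll bs)) →
       uncurry join (split bs) ≡ bs
  go ((false ∷ u) ∷ bs) s d h = cong ((false ∷ u) ∷_)
    (go bs (proj₂ (strictlySorted-∷⁻ _ bs s)) (proj₂ (T-∧⁻ (allL (disjoint (false ∷ u)) bs) d)) h)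
  go ((true ∷ u) ∷ [])               s  d  h = refl
  go ((true ∷ u) ∷ (false ∷ v) ∷ bs) () d  h
  go ((true ∷ u) ∷ (true ∷ v) ∷ bs)  s  () h

strictlySorted-join : ∀ {n} (qs : List (Subset n)) (b : Subset n) → strictlySorted (join qs b) ≡ strictlySorted qs
strictlySorted-join []            b = refl
strictlySorted-join (q ∷ [])      b = refl
strictlySorted-join (q ∷ q′ ∷ qs) b = cong (lexLt q q′ ∧_) (strictlySorted-join (q′ ∷ qs) b)

pairwiseDisjoint-map-false∷ : ∀ {n} (qs : List (Subset n)) →
                              pairwiseDisjoint (map (false ∷_) qs) ≡ pairwiseDisjoint qs
pairwiseDisjoint-map-false∷ []       = refl
pairwiseDisjoint-map-false∷ (q ∷ qs) =
  cong₂ _∧_ (allL-map (disjoint (false ∷ q)) (false ∷_) qs) (pairwiseDisjoint-map-false∷ qs)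

isCover-join : ∀ {n} (qs : List (Subset n)) (b : Subset n) → isCover (join qs b) ≡ coverWith b qs
isCover-join qs b = begin
  isCover (map (false ∷_) qs ++ [ true ∷ b ])
    ≡⟨ isCover-↭ (++-comm (map (false ∷_) qs) [ true ∷ b ]) ⟩
  allL nonempty (map (false ∷_) qs)
    ∧ (allL (disjoint (true ∷ b)) (map (false ∷_) qs) ∧ pairwiseDisjoint (map (false ∷_) qs))
    ∧ full (unionAll ((true ∷ b) ∷ map (false ∷_) qs))
    ≡⟨ cong₂ (λ x y → x ∧ y ∧ full (unionAll ((true ∷ b) ∷ map (false ∷_) qs))) (allL-map nonempty (false ∷_) qs)
             (cong₂ _∧_ (allL-map (disjoint (true ∷ b)) (false ∷_) qs) (pairwiseDisjoint-map-false∷ qs)) ⟩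
  allL nonempty qs ∧ pairwiseDisjoint (b ∷ qs) ∧ full (unionAll ((true ∷ b) ∷ map (false ∷_) qs))
    ≡⟨ cong (λ u → allL nonempty qs ∧ pairwiseDisjoint (b ∷ qs) ∧ full u) unionAll-join ⟩
  coverWith b qs ∎
  where
  open ≡-Reasoning
  unionAll-join : unionAll ((true ∷ b) ∷ map (false ∷_) qs) ≡ true ∷ unionAll (b ∷ qs)
  unionAll-join = begin
    unionAll ((true ∷ b) ∷ map (false ∷_) qs) ≡⟨ unionAll-∷ (true ∷ b) _ ⟩
    (true ∷ b) ∪ unionAll (map (false ∷_) qs) ≡⟨ cong ((true ∷ b) ∪_) (unionAll-map-false∷ qs) ⟩
    true ∷ (b ∪ unionAll qs)                  ≡⟨ cong (true ∷_) (sym (unionAll-∷ b qs)) ⟩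
    true ∷ unionAll (b ∷ qs)                  ∎

isPartition-join : ∀ {n} (qs : List (Subset n)) (b : Subset n) →
                   isPartition (suc n) (join qs b) ≡ strictlySorted qs ∧ coverWith b qs
isPartition-join qs b = cong₂ _∧_ (strictlySorted-join qs b) (isCover-join qs b)

length-join : ∀ {n} (qs : List (Subset n)) (b : Subset n) → length (join qs b) ≡ length qs + 1
length-join qs b = trans (length-++ (map (false ∷_) qs)) (cong (_+ 1) (length-map (false ∷_) qs))

extendBlocks : ∀ {n} (qs : List (Subset n)) → Choice (length qs) → List (Subset (suc n))
extendBlocks qs fresh           = join qs ∅
extendBlocks qs (existing i i<) = join (proj₂ (pick i qs i<)) (proj₁ (pick i qs i<))

reinsert : ∀ {n} → List (Subset n) → Subset n → Σ (List (Subset n)) (Choice ∘ length)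
reinsert qs b with nonempty b
... | false = qs , fresh
... | true  = insert b qs , existing (insertPosition b qs) (insertPosition-< b qs)

restrictBlocks : ∀ {n} → List (Subset (suc n)) → Σ (List (Subset n)) (Choice ∘ length)
restrictBlocks = uncurry reinsert ∘ split

pick-isCover : ∀ {n} (i : ℕ) (qs : List (Subset n)) .(i< : i < length qs) →
               let (b , rest) = pick i qs i< in isCover qs ≡ nonempty b ∧ coverWith b rest
pick-isCover i qs i< = trans (isCover-↭ (pick-↭ i qs i<)) (isCover-∷ (proj₁ (pick i qs i<)) (proj₂ (pick i qs i<)))

extendBlocks-valid : ∀ {n} (qs : List (Subset n)) (c : Choice (length qs)) →
                     T (isPartition n qs) → T (isPartition (suc n) (extendBlocks qs c))
extendBlocks-valid qs fresh v =
  subst T (sym (trans (isPartition-join qs ∅) (cong (strictlySorted qs ∧_) (coverWith-∅ qs)))) v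
extendBlocks-valid qs (existing i i<) v with T-∧⁻ (strictlySorted qs) v
... | s , cov = subst T (sym (isPartition-join (proj₂ (pick i qs i<)) b))
                  (T-∧⁺ (pick-sorted i qs i< s) (proj₂ (T-∧⁻ (nonempty b) (subst T (pick-isCover i qs i<) cov))))
  where b = proj₁ (pick i qs i<)

coverWith⇒distinct : ∀ {n} (b : Subset n) (qs : List (Subset n)) →
                     T (nonempty b) → T (coverWith b qs) → All (_≢ b) qs
coverWith⇒distinct b qs ne cov with T-∧⁻ (allL nonempty qs) cov
... | _ , cov′ with T-∧⁻ (pairwiseDisjoint (b ∷ qs)) cov′
...   | pd , _ = All.map (λ { d refl → nonempty⇒¬disjoint-self b ne d })
                         (allL⇒All (disjoint b) qs (proj₁ (T-∧⁻ (allL (disjoint b) qs) pd)))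

reinsert-valid : ∀ {n} (qs : List (Subset n)) (b : Subset n) →
                 T (strictlySorted qs ∧ coverWith b qs) → T (isPartition n (proj₁ (reinsert qs b)))
reinsert-valid qs b v with nonempty b in ne
... | false = subst T (cong (strictlySorted qs ∧_) (coverWith-∅ qs))
                (subst (λ b → T (strictlySorted qs ∧ coverWith b qs)) (nonempty-false b ne) v)
... | true with T-∧⁻ (strictlySorted qs) v
...   | s , cov = T-∧⁺ (insert-sorted b qs distinct s) (subst T (sym isCover-insert) cov)
  where
  isCover-insert : isCover (insert b qs) ≡ coverWith b qs
  isCover-insert = trans (isCover-↭ (insert-↭ b qs)) (trans (isCover-∷ b qs) (cong (_∧ coverWith b qs) ne))
  distinct : All (_≢ b) qs
  distinct = coverWith⇒distinct b qs (subst T (sym ne) _) cov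

reinsert-nonempty : ∀ {n} (qs : List (Subset n)) {b : Subset n} → T (nonempty b) →
                    reinsert qs b ≡ (insert b qs , existing (insertPosition b qs) (insertPosition-< b qs))
reinsert-nonempty qs {b} ne rewrite Equivalence.to T-≡ ne = refl

restrictBlocks-valid : ∀ {n} (bs : List (Subset (suc n))) →
                       T (isPartition (suc n) bs) → T (isPartition n (proj₁ (restrictBlocks bs)))
restrictBlocks-valid {n} bs v =
  reinsert-valid qs b (subst T (isPartition-join qs b) (subst (T ∘ isPartition (suc n)) (sym (join-split bs v)) v))
  where
  qs = proj₁ (split bs)
  b  = proj₂ (split bs)

extendBlocks-reinsert : ∀ {n} (qs : List (Subset n)) (b : Subset n) → uncurry extendBlocks (reinsert qs b) ≡ join qs b
extendBlocks-reinsert qs b with nonempty b in ne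
... | false = cong (join qs) (sym (nonempty-false b ne))
... | true  = cong (λ (b , rest) → join rest b) (pick-insert b qs)

extendBlocks-restrict : ∀ {n} (bs : List (Subset (suc n))) →
                        T (isPartition (suc n) bs) → uncurry extendBlocks (restrictBlocks bs) ≡ bs
extendBlocks-restrict bs v = trans (extendBlocks-reinsert (proj₁ (split bs)) (proj₂ (split bs))) (join-split bs v)

restrictBlocks-extend : ∀ {n} (qs : List (Subset n)) (c : Choice (length qs)) →
                        T (isPartition n qs) → restrictBlocks (extendBlocks qs c) ≡ (qs , c)
restrictBlocks-extend {n} qs fresh v
  rewrite split-join qs (∅ {n}) | nonempty-∅ n = refl
restrictBlocks-extend qs (existing i i<) v = begin
  uncurry reinsert (split (join rest b))
    ≡⟨ cong (uncurry reinsert) (split-join rest b) ⟩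
  reinsert rest b
    ≡⟨ reinsert-nonempty rest b-nonempty ⟩
  insert b rest , existing (insertPosition b rest) (insertPosition-< b rest)
    ≡⟨ existing-≡ (proj₁ (insert-pick i qs i< sorted)) (proj₂ (insert-pick i qs i< sorted)) ⟩
  qs , existing i i< ∎
  where
  open ≡-Reasoning
  b    = proj₁ (pick i qs i<)
  rest = proj₂ (pick i qs i<)
  sorted = proj₁ (T-∧⁻ (strictlySorted qs) v)
  b-nonempty : T (nonempty b)
  b-nonempty = proj₁ (T-∧⁻ (nonempty b) (subst T (pick-isCover i qs i<) (proj₂ (T-∧⁻ (strictlySorted qs) v))))

length-extendBlocks : ∀ {n} (qs : List (Subset n)) (c : Choice (length qs)) →
                      length (extendBlocks qs c) ≡ length qs + growth c
length-extendBlocks {n} qs fresh = length-join qs ∅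
length-extendBlocks qs (existing i i<) = begin
  length (join rest b) ≡⟨ length-join rest b ⟩
  length rest + 1      ≡⟨ +-comm (length rest) 1 ⟩
  length (b ∷ rest)    ≡⟨ sym (↭-length (pick-↭ i qs i<)) ⟩
  length qs            ≡⟨ sym (+-identityʳ _) ⟩
  length qs + 0        ∎
  where
  open ≡-Reasoning
  b    = proj₁ (pick i qs i<)
  rest = proj₂ (pick i qs i<)

no-blocks : (bs : List (Subset 0)) → T (isPartition 0 bs) → bs ≡ []
no-blocks []       _ = refl
no-blocks ([] ∷ bs) v = ⊥-elim (proj₂ (T-∧⁻ (strictlySorted ([] ∷ bs)) v))

partitionGrowth : ValidGrowth
partitionGrowth = record
  { Raw             = List ∘ Subset
  ; valid           = isPartition
  ; size            = length
  ; empty           = []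
  ; empty-valid     = _
  ; empty-unique    = no-blocks
  ; size-empty      = refl
  ; extend          = extendBlocks
  ; restrict        = restrictBlocks
  ; extend-valid    = extendBlocks-valid
  ; restrict-valid  = restrictBlocks-valid
  ; extend-restrict = extendBlocks-restrict
  ; restrict-extend = restrictBlocks-extend
  ; size-extend     = length-extendBlocks
  }

-- Restricted t-shelves

spineLength : BTree → ℕ
spineLength leaf         = 0
spineLength (node _ _ r) = suc (spineLength r)

graftLeft : ℕ → BTree → BTree
graftLeft m leaf         = node leaf m leaf
graftLeft m (node l x r) = node (graftLeft m l) x r

graft : ℕ → (t : BTree) → Choice (spineLength t) → BTree
graft m leaf         fresh                 = node leaf m leaf
graft m leaf         (existing i ())
graft m (node l x r) fresh                 = node l x (graft m r fresh)
graft m (node l x r) (existing zero    _)  = node (graftLeft m l) x r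
graft m (node l x r) (existing (suc i) i<) = node l x (graft m r (existing i (s<s⁻¹ i<)))

occurs : ℕ → BTree → Bool
occurs m leaf         = false
occurs m (node l x r) = (x ≡ᵇ m) ∨ occurs m l ∨ occurs m r

pruneLeft : ℕ → BTree → BTree
pruneLeft m leaf         = leaf
pruneLeft m (node l y r) = if y ≡ᵇ m then leaf else node (pruneLeft m l) y r

shiftChoice : ∀ {k} → Choice k → Choice (suc k)
shiftChoice fresh          = fresh
shiftChoice (existing i p) = existing (suc i) (s<s p)

prune : ℕ → BTree → Σ BTree (Choice ∘ spineLength)
prune m leaf         = leaf , fresh
prune m (node l x r) =
  if x ≡ᵇ m then leaf , fresh
  else if occurs m l then node (pruneLeft m l) x r , existing 0 z<s
  else Product.map (node l x) shiftChoice (prune m r)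

graft-shiftChoice : ∀ m l x r (c : Choice (spineLength r)) →
                    graft m (node l x r) (shiftChoice c) ≡ node l x (graft m r c)
graft-shiftChoice m l x r fresh          = refl
graft-shiftChoice m l x r (existing i p) = refl

spineLength-graft : ∀ m t (c : Choice (spineLength t)) → spineLength (graft m t c) ≡ spineLength t + growth c
spineLength-graft m leaf         fresh                 = refl
spineLength-graft m leaf         (existing i ())
spineLength-graft m (node l x r) fresh                 = cong suc (spineLength-graft m r fresh)
spineLength-graft m (node l x r) (existing zero _)     = sym (+-identityʳ _)
spineLength-graft m (node l x r) (existing (suc i) i<) = cong suc (spineLength-graft m r _)

labels-graftLeft : ∀ m t → labels (graftLeft m t) ≡ m ∷ labels t
labels-graftLeft m leaf         = refl
labels-graftLeft m (node l x r) = cong (_++ x ∷ labels r) (labels-graftLeft m l)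

↭-shift-past : ∀ m (ls : List ℕ) x {rs rs′ : List ℕ} → rs′ ↭ m ∷ rs → ls ++ x ∷ rs′ ↭ m ∷ ls ++ x ∷ rs
↭-shift-past m ls x {rs} p = ↭.trans (++⁺ˡ ls (↭.trans (prep x p) (swap x m ↭.refl))) (shift m ls (x ∷ rs))

labels-graft : ∀ m t (c : Choice (spineLength t)) → labels (graft m t c) ↭ m ∷ labels t
labels-graft m leaf         fresh                 = ↭.refl
labels-graft m leaf         (existing i ())
labels-graft m (node l x r) fresh                 = ↭-shift-past m (labels l) x (labels-graft m r fresh)
labels-graft m (node l x r) (existing zero _)     = ↭-reflexive (cong (_++ x ∷ labels r) (labels-graftLeft m l))
labels-graft m (node l x r) (existing (suc i) i<) = ↭-shift-past m (labels l) x (labels-graft m r _)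

AllBelow : ℕ → BTree → Set
AllBelow m leaf         = ⊤
AllBelow m (node l x r) = AllBelow m l × x < m × AllBelow m r

childGreater-graftLeft : ∀ {y m} t → y < m → childGreater y (graftLeft m t) ≡ childGreater y t
childGreater-graftLeft leaf         y<m = Equivalence.to T-≡ (<⇒<ᵇ y<m)
childGreater-graftLeft (node _ _ _) y<m = refl

childGreater-graft : ∀ {y m} t (c : Choice (spineLength t)) → y < m → childGreater y (graft m t c) ≡ childGreater y t
childGreater-graft leaf         fresh          y<m = Equivalence.to T-≡ (<⇒<ᵇ y<m)
childGreater-graft leaf         (existing i ()) y<m
childGreater-graft (node _ _ _) fresh          y<m = refl
childGreater-graft (node _ _ _) (existing zero _) y<m = refl
childGreater-graft (node _ _ _) (existing (suc _) _) y<m = refl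

increasing-graftLeft : ∀ m t → AllBelow m t → increasing (graftLeft m t) ≡ increasing t
increasing-graftLeft m leaf         _              = refl
increasing-graftLeft m (node l x r) (bl , x<m , _) =
  cong₂ (λ a b → a ∧ childGreater x r ∧ b ∧ increasing r)
        (childGreater-graftLeft l x<m) (increasing-graftLeft m l bl)

increasing-graft : ∀ m t (c : Choice (spineLength t)) → AllBelow m t → increasing (graft m t c) ≡ increasing t
increasing-graft m leaf         fresh                 _ = refl
increasing-graft m leaf         (existing i ())       _
increasing-graft m (node l x r) fresh                 (_ , x<m , br) =
  cong₂ (λ a b → childGreater x l ∧ a ∧ increasing l ∧ b)
        (childGreater-graft r fresh x<m) (increasing-graft m r fresh br)
increasing-graft m (node l x r) (existing zero _)     (bl , x<m , _) =
  cong₂ (λ a b → a ∧ childGreater x r ∧ b ∧ increasing r)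
        (childGreater-graftLeft l x<m) (increasing-graftLeft m l bl)
increasing-graft m (node l x r) (existing (suc i) i<) (_ , x<m , br) =
  cong₂ (λ a b → childGreater x l ∧ a ∧ increasing l ∧ b)
        (childGreater-graft r _ x<m) (increasing-graft m r _ br)

hasRightChild-graftLeft : ∀ m t → hasRightChild (graftLeft m t) ≡ hasRightChild t
hasRightChild-graftLeft m leaf                = refl
hasRightChild-graftLeft m (node _ _ leaf)     = refl
hasRightChild-graftLeft m (node _ _ (node _ _ _)) = refl

noLeftChildWithRightChild-graftLeft : ∀ m t →
                                      noLeftChildWithRightChild (graftLeft m t) ≡ noLeftChildWithRightChild t
noLeftChildWithRightChild-graftLeft m leaf         = refl
noLeftChildWithRightChild-graftLeft m (node l x r) =
  cong₂ (λ a b → not a ∧ b ∧ noLeftChildWithRightChild r)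
        (hasRightChild-graftLeft m l) (noLeftChildWithRightChild-graftLeft m l)

noLeftChildWithRightChild-graft : ∀ m t (c : Choice (spineLength t)) →
                                  noLeftChildWithRightChild (graft m t c) ≡ noLeftChildWithRightChild t
noLeftChildWithRightChild-graft m leaf         fresh             = refl
noLeftChildWithRightChild-graft m leaf         (existing i ())
noLeftChildWithRightChild-graft m (node l x r) fresh             =
  cong (λ b → not (hasRightChild l) ∧ noLeftChildWithRightChild l ∧ b) (noLeftChildWithRightChild-graft m r fresh)
noLeftChildWithRightChild-graft m (node l x r) (existing zero _) =
  cong₂ (λ a b → not a ∧ b ∧ noLeftChildWithRightChild r)
        (hasRightChild-graftLeft m l) (noLeftChildWithRightChild-graftLeft m l)
noLeftChildWithRightChild-graft m (node l x r) (existing (suc i) i<) =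
  cong (λ b → not (hasRightChild l) ∧ noLeftChildWithRightChild l ∧ b) (noLeftChildWithRightChild-graft m r _)

increasing⁻ : ∀ l x r → T (increasing (node l x r)) →
              T (childGreater x l) × T (childGreater x r) × T (increasing l) × T (increasing r)
increasing⁻ l x r v with T-∧⁻ (childGreater x l) v
... | gl , v′ with T-∧⁻ (childGreater x r) v′
...   | gr , v″ = gl , gr , T-∧⁻ (increasing l) v″

noLeftChildWithRightChild⁻ : ∀ l x r → T (noLeftChildWithRightChild (node l x r)) →
                             T (not (hasRightChild l)) × T (noLeftChildWithRightChild l) ×
                             T (noLeftChildWithRightChild r)
noLeftChildWithRightChild⁻ l x r v with T-∧⁻ (not (hasRightChild l)) v
... | h , v′ = h , T-∧⁻ (noLeftChildWithRightChild l) v′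

≡ᵇ-refl : ∀ m → (m ≡ᵇ m) ≡ true
≡ᵇ-refl m = Equivalence.to T-≡ (≡⇒≡ᵇ m m refl)

<⇒≡ᵇ-false : ∀ {x m} → x < m → (x ≡ᵇ m) ≡ false
<⇒≡ᵇ-false {x} {m} x<m with x ≡ᵇ m in e
... | true  = ⊥-elim (<⇒≢ x<m (≡ᵇ⇒≡ x m (Equivalence.from T-≡ e)))
... | false = refl

occurs-below : ∀ {m} t → AllBelow m t → occurs m t ≡ false
occurs-below leaf         _              = refl
occurs-below (node l x r) (bl , x<m , br)
  rewrite <⇒≡ᵇ-false x<m | occurs-below l bl | occurs-below r br = refl

occurs-graftLeft : ∀ m t → occurs m (graftLeft m t) ≡ true
occurs-graftLeft m leaf         rewrite ≡ᵇ-refl m = refl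
occurs-graftLeft m (node l y r) rewrite occurs-graftLeft m l = ∨-zeroʳ (y ≡ᵇ m)

pruneLeft-graftLeft : ∀ m t → AllBelow m t → pruneLeft m (graftLeft m t) ≡ t
pruneLeft-graftLeft m leaf         _              rewrite ≡ᵇ-refl m = refl
pruneLeft-graftLeft m (node l y r) (bl , y<m , _) rewrite <⇒≡ᵇ-false y<m =
  cong (λ l → node l y r) (pruneLeft-graftLeft m l bl)

prune-graft : ∀ m t (c : Choice (spineLength t)) → AllBelow m t → prune m (graft m t c) ≡ (t , c)
prune-graft m leaf         fresh                 _ rewrite ≡ᵇ-refl m = refl
prune-graft m leaf         (existing i ())       _
prune-graft m (node l x r) fresh                 (bl , x<m , br)
  rewrite <⇒≡ᵇ-false x<m | occurs-below l bl | prune-graft m r fresh br = refl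
prune-graft m (node l x r) (existing zero _)     (bl , x<m , br)
  rewrite <⇒≡ᵇ-false x<m | occurs-graftLeft m l | pruneLeft-graftLeft m l bl = refl
prune-graft m (node l x r) (existing (suc i) i<) (bl , x<m , br)
  rewrite <⇒≡ᵇ-false x<m | occurs-below l bl | prune-graft m r (existing i (s<s⁻¹ i<)) br = refl

leaf-below-max : ∀ {m} t → T (childGreater m t) → AllBelow (suc m) t → t ≡ leaf
leaf-below-max leaf         _   _             = refl
leaf-below-max (node _ y _) m<y (_ , y<1+m , _) = ⊥-elim (<⇒≱ (<ᵇ⇒< _ y m<y) (s≤s⁻¹ y<1+m))

-- A left child has no right child, so below a spine node the tree is a left chain and
-- the maximum m sits at its bottom.
graftLeft-pruneLeft : ∀ m t → AllBelow (suc m) t → T (increasing t) → T (not (hasRightChild t)) →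
                      T (noLeftChildWithRightChild t) → T (occurs m t) → graftLeft m (pruneLeft m t) ≡ t
graftLeft-pruneLeft m leaf                    _ _ _  _ ()
graftLeft-pruneLeft m (node l y (node _ _ _)) _ _ () _ _
graftLeft-pruneLeft m (node l y leaf) (bl , _) inc _ nl occ
  with increasing⁻ l y leaf inc | noLeftChildWithRightChild⁻ l y leaf nl | y ≡ᵇ m in e
... | y<l , _ , incl , _ | _ | true
  with refl ← ≡ᵇ⇒≡ y m (Equivalence.from T-≡ e)
  with refl ← leaf-below-max l y<l bl = refl
... | _ , _ , incl , _ | hl , nll , _ | false =
  cong (λ l → node l y leaf) (graftLeft-pruneLeft m l bl incl hl nll (subst T (∨-identityʳ _) occ))

graft-prune : ∀ m t → AllBelow (suc m) t → T (increasing t) → T (noLeftChildWithRightChild t) →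
              T (occurs m t) → uncurry (graft m) (prune m t) ≡ t
graft-prune m leaf         _             _   _  ()
graft-prune m (node l x r) (bl , _ , br) inc nl occ
  with increasing⁻ l x r inc | noLeftChildWithRightChild⁻ l x r nl | x ≡ᵇ m in e
... | x<l , x<r , _ , _ | _ | true
  with refl ← ≡ᵇ⇒≡ x m (Equivalence.from T-≡ e)
  with refl ← leaf-below-max l x<l bl | refl ← leaf-below-max r x<r br = refl
... | _ , _ , incl , incr | hl , nll , nlr | false with occurs m l in e′
...   | true  = cong (λ l → node l x r) (graftLeft-pruneLeft m l bl incl hl nll (Equivalence.from T-≡ e′))
...   | false = trans (graft-shiftChoice m l x (proj₁ (prune m r)) (proj₂ (prune m r)))
                      (cong (node l x) (graft-prune m r br incr nlr occ))

∈-range⇒≥ : ∀ {a k u} → u ∈ range a k → a ≤ u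
∈-range⇒≥ {k = suc k} (here refl) = ≤-refl
∈-range⇒≥ {k = suc k} (there u∈)  = <⇒≤ (∈-range⇒≥ u∈)

∈-range⇒< : ∀ {a k u} → u ∈ range a k → u < a + k
∈-range⇒< {a} {suc k} (here refl) = subst (a <_) (sym (+-suc a k)) (s≤s (m≤m+n a k))
∈-range⇒< {a} {suc k} {u} (there u∈) = subst (u <_) (sym (+-suc a k)) (∈-range⇒< u∈)

last∈range : ∀ a k → a + k ∈ range a (suc k)
last∈range a zero    = here (+-identityʳ a)
last∈range a (suc k) = there (subst (_∈ range (suc a) (suc k)) (sym (+-suc a k)) (last∈range (suc a) k))

length-range : ∀ a k → length (range a k) ≡ k
length-range a zero    = refl
length-range a (suc k) = cong suc (length-range (suc a) k)

range-suc-↭ : ∀ a k → range a (suc k) ↭ a + k ∷ range a k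
range-suc-↭ a zero    = ↭-reflexive (cong [_] (sym (+-identityʳ a)))
range-suc-↭ a (suc k) = ↭.trans (prep a (range-suc-↭ (suc a) k))
                          (↭.trans (swap a _ ↭.refl) (↭-reflexive (cong (_∷ range a (suc k)) (sym (+-suc a k)))))

↭-range : ∀ a k (xs : List ℕ) → length xs ≡ k → (∀ {u} → u ∈ range a k → u ∈ xs) → xs ↭ range a k
↭-range a zero    []       _   _     = ↭.refl
↭-range a zero    (_ ∷ _)  ()  _
↭-range a (suc k) xs       len cover with ∈-∃++ (cover (here refl))
... | ys , zs , refl = ↭.trans (shift a ys zs) (prep a (↭-range (suc a) k (ys ++ zs) len′ cover′))
  where
  len′ : length (ys ++ zs) ≡ k
  len′ = suc-injective (trans (sym (↭-length (shift a ys zs))) len)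
  cover′ : ∀ {u} → u ∈ range (suc a) k → u ∈ ys ++ zs
  cover′ u∈ with ∈-resp-↭ (shift a ys zs) (cover (there u∈))
  ... | here refl = ⊥-elim (<-irrefl refl (∈-range⇒≥ u∈))
  ... | there u∈′ = u∈′

anyL-≡ᵇ⇒∈ : ∀ k (xs : List ℕ) → T (anyL (_≡ᵇ k) xs) → k ∈ xs
anyL-≡ᵇ⇒∈ k (x ∷ xs) p with Equivalence.to (T-∨ {x ≡ᵇ k}) p
... | inj₁ x≡k = here (sym (≡ᵇ⇒≡ x k x≡k))
... | inj₂ p′  = there (anyL-≡ᵇ⇒∈ k xs p′)

∈⇒anyL-≡ᵇ : ∀ {k} {xs : List ℕ} → k ∈ xs → T (anyL (_≡ᵇ k) xs)
∈⇒anyL-≡ᵇ {k}         (here refl) = T-∨⁺ˡ (≡⇒≡ᵇ k k refl)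
∈⇒anyL-≡ᵇ {k} {x ∷ _} (there k∈)  = T-∨⁺ʳ (x ≡ᵇ k) (∈⇒anyL-≡ᵇ k∈)

All⇒allL : ∀ {A : Set} (p : A → Bool) {xs : List A} → All (T ∘ p) xs → T (allL p xs)
All⇒allL p []         = _
All⇒allL p (px ∷ pxs) = T-∧⁺ px (All⇒allL p pxs)

bijLabels⇒↭ : ∀ n t → T (bijLabels n t) → labels t ↭ range 1 n
bijLabels⇒↭ n t v with T-∧⁻ (length (labels t) ≡ᵇ n) v
... | len , cover = ↭-range 1 n (labels t) (≡ᵇ⇒≡ _ n len)
                      (λ {u} u∈ → anyL-≡ᵇ⇒∈ u (labels t) (All.lookup (allL⇒All _ (range 1 n) cover) u∈))

↭⇒bijLabels : ∀ n t → labels t ↭ range 1 n → T (bijLabels n t)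
↭⇒bijLabels n t p = T-∧⁺ (≡⇒≡ᵇ _ n (trans (↭-length p) (length-range 1 n)))
                         (All⇒allL _ (All.tabulate (λ u∈ → ∈⇒anyL-≡ᵇ (∈-resp-↭ (↭-sym p) u∈))))

allBelow : ∀ m t → (∀ {x} → x ∈ labels t → x < m) → AllBelow m t
allBelow m leaf         _     = _
allBelow m (node l x r) below =
  allBelow m l (below ∘ ∈-++⁺ˡ) , below (∈-++⁺ʳ (labels l) (here refl)) ,
  allBelow m r (below ∘ ∈-++⁺ʳ (labels l) ∘ there)

↭range⇒AllBelow : ∀ n t → labels t ↭ range 1 n → AllBelow (suc n) t
↭range⇒AllBelow n t p = allBelow (suc n) t (∈-range⇒< ∘ ∈-resp-↭ p)

∈⇒occurs : ∀ m t → m ∈ labels t → T (occurs m t)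
∈⇒occurs m (node l x r) m∈ with ∈-++⁻ (labels l) m∈
... | inj₁ m∈l         = T-∨⁺ʳ (x ≡ᵇ m) (T-∨⁺ˡ (∈⇒occurs m l m∈l))
... | inj₂ (here refl) = T-∨⁺ˡ (≡⇒≡ᵇ m m refl)
... | inj₂ (there m∈r) = T-∨⁺ʳ (x ≡ᵇ m) (T-∨⁺ʳ (occurs m l) (∈⇒occurs m r m∈r))

isRestrictedShelf : ℕ → BTree → Bool
isRestrictedShelf n t = isTShelf n t ∧ noLeftChildWithRightChild t

isRestrictedShelf⁻ : ∀ n t → T (isRestrictedShelf n t) →
                     labels t ↭ range 1 n × T (increasing t) × T (noLeftChildWithRightChild t)
isRestrictedShelf⁻ n t v with T-∧⁻ (isTShelf n t) v
... | sh , nl with T-∧⁻ (bijLabels n t) sh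
...   | bij , inc = bijLabels⇒↭ n t bij , inc , nl

isRestrictedShelf⁺ : ∀ n t → labels t ↭ range 1 n → T (increasing t) → T (noLeftChildWithRightChild t) →
                     T (isRestrictedShelf n t)
isRestrictedShelf⁺ n t p inc nl = T-∧⁺ (T-∧⁺ (↭⇒bijLabels n t p) inc) nl

graft-valid : ∀ {n} t (c : Choice (spineLength t)) →
              T (isRestrictedShelf n t) → T (isRestrictedShelf (suc n) (graft (suc n) t c))
graft-valid {n} t c v with isRestrictedShelf⁻ n t v
... | lab , inc , nl = isRestrictedShelf⁺ (suc n) (graft (suc n) t c)
  (↭.trans (labels-graft (suc n) t c) (↭.trans (prep (suc n) lab) (↭-sym (range-suc-↭ 1 n))))
  (subst T (sym (increasing-graft (suc n) t c (↭range⇒AllBelow n t lab))) inc)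
  (subst T (sym (noLeftChildWithRightChild-graft (suc n) t c)) nl)

graft-prune-max : ∀ n t → T (isRestrictedShelf (suc n) t) → uncurry (graft (suc n)) (prune (suc n) t) ≡ t
graft-prune-max n t v with isRestrictedShelf⁻ (suc n) t v
... | lab , inc , nl = graft-prune (suc n) t (↭range⇒AllBelow (suc n) t lab) inc nl
                         (∈⇒occurs (suc n) t (∈-resp-↭ (↭-sym lab) (last∈range 1 n)))

prune-valid : ∀ {n} t → T (isRestrictedShelf (suc n) t) → T (isRestrictedShelf n (proj₁ (prune (suc n) t)))
prune-valid {n} t v with isRestrictedShelf⁻ (suc n) t v | graft-prune-max n t v
... | lab , inc , nl | eq = isRestrictedShelf⁺ n t′ lab′
  (subst T (trans (cong increasing eq′) (increasing-graft (suc n) t′ c (↭range⇒AllBelow n t′ lab′))) inc)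
  (subst T (trans (cong noLeftChildWithRightChild eq′) (noLeftChildWithRightChild-graft (suc n) t′ c)) nl)
  where
  t′  = proj₁ (prune (suc n) t)
  c   = proj₂ (prune (suc n) t)
  eq′ : t ≡ graft (suc n) t′ c
  eq′ = sym eq
  lab′ : labels t′ ↭ range 1 n
  lab′ = drop-∷ (↭.trans (↭-sym (labels-graft (suc n) t′ c))
                   (↭.trans (↭-reflexive (cong labels eq)) (↭.trans lab (range-suc-↭ 1 n))))

no-nodes : ∀ t → T (isRestrictedShelf 0 t) → t ≡ leaf
no-nodes leaf         _ = refl
no-nodes (node l x r) v
  with () ← ++-conicalʳ (labels l) _ (↭-empty-inv (proj₁ (isRestrictedShelf⁻ 0 (node l x r) v)))

shelfGrowth : ValidGrowth
shelfGrowth = record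
  { Raw             = λ _ → BTree
  ; valid           = isRestrictedShelf
  ; size            = spineLength
  ; empty           = leaf
  ; empty-valid     = _
  ; empty-unique    = no-nodes
  ; size-empty      = refl
  ; extend          = λ {n} → graft (suc n)
  ; restrict        = λ {n} → prune (suc n)
  ; extend-valid    = graft-valid
  ; restrict-valid  = prune-valid
  ; extend-restrict = λ {n} → graft-prune-max n
  ; restrict-extend = λ {n} t c v →
                        prune-graft (suc n) t c (↭range⇒AllBelow n t (proj₁ (isRestrictedShelf⁻ n t v)))
  ; size-extend     = λ {n} → spineLength-graft (suc n)
  }

theorem10 : (n : ℕ) → Partition n ⤖ RestrictedTShelf n
theorem10 = growthFamily-⤖ (ValidGrowth.growthFamily partitionGrowth) (ValidGrowth.growthFamily shelfGrowth)
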